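{- Let $p\ge 7$ be a prime. Then $$H_3(p)\equiv \frac{R_3(p)}{3}-\frac{R_1(p)R_2(p)}{2}\pmod{p^6}$$ and $$H_4(p)\equiv -\frac{R_4(p)}{4}+\frac{(R_2(p))^2}{8}\pmod{p^4}.$$ In particular, $p^2\mid H_3(p)$, $p\mid H_2(p)$ and $p\mid H_4(p)$.
   Context: For a prime $p$ and positive integer $n$, $R_n(p)=\sum_{k=1}^{p-1}\frac{1}{k^n}$ and, for $n\le p-1$, $H_n(p)=\sum_{1\le i_1<i_2<\cdots<i_n\le p-1}\frac{1}{i_1i_2\cdots i_n}$. For rational numbers $a,b$ whose denominators are not divisible by $p$, $a\equiv b\pmod{p^m}$ means $a-b=p^m c$ with $c$ rational with denominator not divisible by $p$; and $p^m\mid a$ means $a\equiv 0\pmod{p^m}$. -}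

module Defs where

open import Data.Nat as ℕ using (ℕ; zero; suc)
open import Data.Nat.Divisibility using (_∣_)
open import Data.Integer as ℤ using (ℤ; +_)
open import Data.Rational as ℚ using (ℚ; _/_; _+_; _*_; _-_; 0ℚ; 1ℚ; ↧ₙ_)
open import Data.Product using (Σ; _×_)
open import Relation.Nullary using (¬_)
open import Relation.Binary.PropositionalEquality using (_≡_)

_^ℚ_ : ℚ → ℕ → ℚ
q ^ℚ zero  = 1ℚ
q ^ℚ suc n = q * (q ^ℚ n)

inv : ℕ → ℚ
inv j = (+ 1) / suc j

Σ[1…_] : ℕ → (ℕ → ℚ) → ℚ
Σ[1… zero ] f  = 0ℚ
Σ[1… suc m ] f = Σ[1… m ] f + f (suc m)

R : ℕ → ℕ → ℚ
R n p = Σ[1… p ℕ.∸ 1 ] (λ k → (inv (k ℕ.∸ 1)) ^ℚ n)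

-- e n m = Σ_{1 ≤ i_1 < ... < i_n ≤ m} 1/(i_1 ⋯ i_n),
-- written as a nested sum over the largest index i_n = i:
--   e 0 m = 1 (empty product),  e (n+1) m = Σ_{i=1}^{m} (1/i) · e n (i-1)
e : ℕ → ℕ → ℚ
e zero    m = 1ℚ
e (suc n) m = Σ[1… m ] (λ i → inv (i ℕ.∸ 1) * e n (i ℕ.∸ 1))

H : ℕ → ℕ → ℚ
H n p = e n (p ℕ.∸ 1)

pIntegral : ℕ → ℚ → Set
pIntegral p c = ¬ (p ∣ ↧ₙ c)

_≡_[mod_^_] : ℚ → ℚ → ℕ → ℕ → Set
a ≡ b [mod p ^ m ] = Σ ℚ (λ c → pIntegral p c × (a - b ≡ ((+ p) / 1) ^ℚ m * c))

_^_∣ℚ_ : ℕ → ℕ → ℚ → Set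
p ^ m ∣ℚ a = a ≡ 0ℚ [mod p ^ m ]

-- Newton's identities write H₂, H₃, H₄ as polynomials in R₁, …, R₄ whose
-- coefficients have denominators dividing 24, hence prime to p ≥ 7.
-- Since k ↦ k⁻¹ mod p permutes 1, …, p-1, we get Rₙ ≡ Σ kⁿ (mod p), and the
-- closed forms of Σ k² and Σ k⁴ are multiples of p, so p ∣ R₂ and p ∣ R₄.
-- Pairing k with p - k, 1/k + 1/(p-k) = p/(k(p-k)) gives
-- 2 R₁ + p R₂ ≡ 0 and 2 R₃ + 3 p R₄ ≡ 0 (mod p²), hence p² ∣ R₁ and p² ∣ R₃.
-- Then H₃ - R₃/3 + R₁R₂/2 = R₁³/6 is divisible by p⁶, and
-- H₄ - R₂²/8 + R₄/4 = R₁⁴/24 - R₁²R₂/4 + R₁R₃/3 by p⁴.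
module Submission where

open import Defs
open import Data.Nat as ℕ using (ℕ; zero; suc; _∸_; _≤_; _<_; s≤s; z≤n)
import Data.Nat.Properties as ℕ
open import Data.Nat.DivMod using (m≡m%n+[m/n]*n; %-distribˡ-*; m%n%n≡m%n; m%n<n; [m+kn]%n≡m%n; [m+n]%n≡m%n; m<n⇒m%n≡m)
open import Data.Nat.Divisibility using (_∣_; divides; ∣-trans; ∣1⇒≡1; ∣⇒≤; ∣m+n∣m⇒∣n; n∣m*n)
open import Data.Nat.Primality using (Prime; euclidsLemma; ¬prime[1])
open import Data.Nat.Coprimality using (prime⇒coprime; coprime-Bézout)
open import Data.Nat.GCD using (module Bézout)
import Data.Nat.Solver
open import Data.Integer as ℤ using (+_)
import Data.Integer.Properties as ℤ
import Data.Integer.GCD as ℤ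
open import Data.Rational as ℚ using (ℚ; 0ℚ; 1ℚ; ↧ₙ_; fromℚᵘ)
open import Data.Rational.Unnormalised as ℚᵘ using (mkℚᵘ; *≡*)
import Data.Rational.Unnormalised.Properties as ℚᵘ
import Data.Rational.Properties as ℚ
import Data.Rational.Solver
open import Data.Product using (∃; _×_; _,_; proj₁; proj₂; uncurry)
open import Data.Sum using (inj₁; inj₂)
open import Function using (_∘_; _$_)
open import Relation.Nullary using (¬_; Dec; yes; no; contradiction)
open import Relation.Binary.PropositionalEquality
  using (_≡_; _≢_; refl; sym; trans; cong; cong₂; subst; module ≡-Reasoning)

module ModularInverse (m : ℕ) (p-prime : Prime (suc m)) where

  open import Data.Nat using (_+_; _*_; _%_; _/_; _≤?_)
  open Data.Nat.Solver.+-*-Solver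

  p : ℕ
  p = suc m

  1≤m : 1 ≤ m
  1≤m = ℕ.n≢0⇒n>0 λ { refl → ¬prime[1] p-prime }

  p∣⇒≡0 : ∀ {d} → d ≤ m → p ∣ d → d ≡ 0
  p∣⇒≡0 {zero}  _   _   = refl
  p∣⇒≡0 {suc _} d≤m p∣d = contradiction (∣⇒≤ p∣d) (ℕ.<⇒≱ (s≤s d≤m))

  IsInverse : ℕ → ℕ → Set
  IsInverse k s = (k * s) % p ≡ 1

  IsInverse⇒≡1+qp : ∀ k s → IsInverse k s → k * s ≡ 1 + (k * s / p) * p
  IsInverse⇒≡1+qp k s ks≡1 = trans (m≡m%n+[m/n]*n (k * s) p) (cong (_+ (k * s / p) * p) ks≡1)

  private
    inverse-unique-≤ : ∀ {k s s′} → 1 ≤ k → k ≤ m → s ≤ s′ → s′ ≤ m →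
                       IsInverse k s → IsInverse k s′ → s ≡ s′
    inverse-unique-≤ {k} {s} {s′} 1≤k k≤m s≤s′ s′≤m ks≡1 ks′≡1 = begin
      s          ≡⟨ ℕ.+-identityʳ s ⟨
      s + 0      ≡⟨ cong (λ z → s + z) (sym d≡0) ⟩
      s + d      ≡⟨ ℕ.m+[n∸m]≡n s≤s′ ⟩
      s′         ∎
      where
      open ≡-Reasoning
      d = s′ ∸ s
      -- k s′ = k s + k d with k s ≡ k s′ ≡ 1, so p ∣ k d
      qp+kd≡q′p : (k * s / p) * p + k * d ≡ (k * s′ / p) * p
      qp+kd≡q′p = ℕ.+-cancelˡ-≡ 1 _ _ (begin
        1 + ((k * s / p) * p + k * d)   ≡⟨ ℕ.+-assoc 1 _ (k * d) ⟨
        1 + (k * s / p) * p + k * d     ≡⟨ cong (_+ k * d) (IsInverse⇒≡1+qp k s ks≡1) ⟨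
        k * s + k * d                   ≡⟨ ℕ.*-distribˡ-+ k s d ⟨
        k * (s + d)                     ≡⟨ cong (k *_) (ℕ.m+[n∸m]≡n s≤s′) ⟩
        k * s′                          ≡⟨ IsInverse⇒≡1+qp k s′ ks′≡1 ⟩
        1 + (k * s′ / p) * p            ∎)
      p∣kd : p ∣ k * d
      p∣kd = ∣m+n∣m⇒∣n (divides (k * s′ / p) qp+kd≡q′p) (n∣m*n (k * s / p))
      d≡0 : d ≡ 0
      d≡0 with euclidsLemma k d p-prime p∣kd
      ... | inj₁ p∣k = contradiction (p∣⇒≡0 k≤m p∣k) (ℕ.n>0⇒n≢0 1≤k)
      ... | inj₂ p∣d = p∣⇒≡0 (ℕ.≤-trans (ℕ.m∸n≤m s′ s) s′≤m) p∣d

  inverse-unique : ∀ {k s s′} → 1 ≤ k → k ≤ m → s ≤ m → s′ ≤ m →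
                   IsInverse k s → IsInverse k s′ → s ≡ s′
  inverse-unique {s = s} {s′} 1≤k k≤m s≤m s′≤m ks≡1 ks′≡1 with ℕ.≤-total s s′
  ... | inj₁ s≤s′ = inverse-unique-≤ 1≤k k≤m s≤s′ s′≤m ks≡1 ks′≡1
  ... | inj₂ s′≤s = sym (inverse-unique-≤ 1≤k k≤m s′≤s s≤m ks′≡1 ks≡1)

  private
    1%p≡1 : 1 % p ≡ 1
    1%p≡1 = m<n⇒m%n≡m (s≤s 1≤m)

    bézout-inverse : ∀ {k} → Bézout.Identity 1 p k → ∃ λ s → IsInverse k s
    bézout-inverse {k} (Bézout.-+ x y 1+xp≡yk) = y , (begin
      (k * y) % p          ≡⟨ cong (_% p) (trans (ℕ.*-comm k y) (sym 1+xp≡yk)) ⟩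
      (1 + x * p) % p      ≡⟨ [m+kn]%n≡m%n 1 x p ⟩
      1 % p                ≡⟨ 1%p≡1 ⟩
      1                    ∎)
      where open ≡-Reasoning
    -- here y k ≡ -1, so k (y m) ≡ - m ≡ 1 (mod p)
    bézout-inverse {k} (Bézout.+- x y 1+yk≡xp) = y * m , (begin
      (k * (y * m)) % p          ≡⟨ [m+n]%n≡m%n (k * (y * m)) p ⟨
      (k * (y * m) + p) % p      ≡⟨ cong (_% p) kym+p≡1+xmp ⟩
      (1 + (x * m) * p) % p      ≡⟨ [m+kn]%n≡m%n 1 (x * m) p ⟩
      1 % p                      ≡⟨ 1%p≡1 ⟩
      1                          ∎)
      where
      open ≡-Reasoning
      kym+p≡1+xmp : k * (y * m) + p ≡ 1 + (x * m) * p
      kym+p≡1+xmp = begin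
        k * (y * m) + suc m    ≡⟨ solve 3 (λ k y m → k :* (y :* m) :+ (con 1 :+ m) := con 1 :+ (con 1 :+ y :* k) :* m) refl k y m ⟩
        1 + (1 + y * k) * m    ≡⟨ cong (λ z → 1 + z * m) 1+yk≡xp ⟩
        1 + x * p * m          ≡⟨ cong (λ z → 1 + z) (solve 3 (λ x p m → x :* p :* m := x :* m :* p) refl x p m) ⟩
        1 + (x * m) * p        ∎

    inverse-exists : ∀ {k} → 1 ≤ k → k ≤ m → ∃ λ s → 1 ≤ s × s ≤ m × IsInverse k s
    inverse-exists {k@(suc _)} 1≤k k≤m = reduce (bézout-inverse (coprime-Bézout (prime⇒coprime p-prime (s≤s k≤m))))
      where
      reduce : (∃ λ s₀ → IsInverse k s₀) → ∃ λ s → 1 ≤ s × s ≤ m × IsInverse k s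
      reduce (s₀ , ks₀≡1) = s₀ % p , 1≤s , ℕ.≤-pred (m%n<n s₀ p) , ks≡1
        where
        ks≡1 : IsInverse k (s₀ % p)
        ks≡1 = begin
          (k * (s₀ % p)) % p                ≡⟨ %-distribˡ-* k (s₀ % p) p ⟩
          ((k % p) * (s₀ % p % p)) % p      ≡⟨ cong (λ z → ((k % p) * z) % p) (m%n%n≡m%n s₀ p) ⟩
          ((k % p) * (s₀ % p)) % p          ≡⟨ %-distribˡ-* k s₀ p ⟨
          (k * s₀) % p                      ≡⟨ ks₀≡1 ⟩
          1                                 ∎
          where open ≡-Reasoning
        1≤s : 1 ≤ s₀ % p
        1≤s = ℕ.n≢0⇒n>0 λ s≡0 →
          ℕ.0≢1+n (trans (cong (_% p) (sym (ℕ.*-zeroʳ k))) (trans (cong (λ z → (k * z) % p) (sym s≡0)) ks≡1))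

  inverse : ℕ → ℕ
  inverse k with 1 ≤? k | k ≤? m
  ... | yes 1≤k | yes k≤m = proj₁ (inverse-exists 1≤k k≤m)
  ... | _       | _       = 0

  inverse-spec : ∀ {k} → 1 ≤ k → k ≤ m → 1 ≤ inverse k × inverse k ≤ m × IsInverse k (inverse k)
  inverse-spec {k} 1≤k k≤m with 1 ≤? k | k ≤? m
  ... | yes 1≤k′ | yes k≤m′ = proj₂ (inverse-exists 1≤k′ k≤m′)
  ... | no  1≰k  | _        = contradiction 1≤k 1≰k
  ... | yes _    | no  k≰m  = contradiction k≤m k≰m

  inverse-range : ∀ {k} → 1 ≤ k → k ≤ m → 1 ≤ inverse k × inverse k ≤ m
  inverse-range 1≤k k≤m = let 1≤s , s≤m , _ = inverse-spec 1≤k k≤m in 1≤s , s≤m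

  inverse-involutive : ∀ {k} → 1 ≤ k → k ≤ m → inverse (inverse k) ≡ k
  inverse-involutive {k} 1≤k k≤m =
    let 1≤s , s≤m , ks≡1 = inverse-spec 1≤k k≤m
        _ , s′≤m , ss′≡1 = inverse-spec 1≤s s≤m
    in inverse-unique 1≤s s≤m s′≤m k≤m ss′≡1 (trans (cong (_% p) (ℕ.*-comm (inverse k) k)) ks≡1)

-- Opened only here, since ModularInverse uses the ℕ operators of the same names.
open import Data.Rational using (_/_; _+_; _*_; _-_; -_)
open Data.Rational.Solver.+-*-Solver

↧ₙ-/-∣ : ∀ i n .{{_ : ℕ.NonZero n}} → ↧ₙ (i / n) ∣ n
↧ₙ-/-∣ i n = divides ℤ.∣ g ∣ (begin
  n                                 ≡⟨ cong ℤ.∣_∣ (ℚ.↧-/ i n) ⟨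
  ℤ.∣ ℚ.↧ (i / n) ℤ.* g ∣           ≡⟨ ℤ.abs-* (ℚ.↧ (i / n)) g ⟩
  ↧ₙ (i / n) ℕ.* ℤ.∣ g ∣            ≡⟨ ℕ.*-comm (↧ₙ (i / n)) ℤ.∣ g ∣ ⟩
  ℤ.∣ g ∣ ℕ.* ↧ₙ (i / n)            ∎)
  where
  open ≡-Reasoning
  g = ℤ.gcd i (+ n)

↧ₙ-+-∣ : ∀ x y → ↧ₙ (x + y) ∣ ↧ₙ x ℕ.* ↧ₙ y
↧ₙ-+-∣ x@record{} y@record{} = ↧ₙ-/-∣ (ℚ.↥ x ℤ.* ℚ.↧ y ℤ.+ ℚ.↥ y ℤ.* ℚ.↧ x) (↧ₙ x ℕ.* ↧ₙ y)

↧ₙ-*-∣ : ∀ x y → ↧ₙ (x * y) ∣ ↧ₙ x ℕ.* ↧ₙ y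
↧ₙ-*-∣ x@record{} y@record{} = ↧ₙ-/-∣ (ℚ.↥ x ℤ.* ℚ.↥ y) (↧ₙ x ℕ.* ↧ₙ y)

fromℕ : ℕ → ℚ
fromℕ n = + n / 1

fromℚᵘ-homo-+ : ∀ u v → fromℚᵘ (u ℚᵘ.+ v) ≡ fromℚᵘ u + fromℚᵘ v
fromℚᵘ-homo-+ u v = ℚ.toℚᵘ-injective (ℚᵘ.≃-trans (ℚ.toℚᵘ-fromℚᵘ (u ℚᵘ.+ v)) (ℚᵘ.≃-sym
  (ℚᵘ.≃-trans (ℚ.toℚᵘ-homo-+ (fromℚᵘ u) (fromℚᵘ v)) (ℚᵘ.+-cong (ℚ.toℚᵘ-fromℚᵘ u) (ℚ.toℚᵘ-fromℚᵘ v)))))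

fromℚᵘ-homo-* : ∀ u v → fromℚᵘ (u ℚᵘ.* v) ≡ fromℚᵘ u * fromℚᵘ v
fromℚᵘ-homo-* u v = ℚ.toℚᵘ-injective (ℚᵘ.≃-trans (ℚ.toℚᵘ-fromℚᵘ (u ℚᵘ.* v)) (ℚᵘ.≃-sym
  (ℚᵘ.≃-trans (ℚ.toℚᵘ-homo-* (fromℚᵘ u) (fromℚᵘ v)) (ℚᵘ.*-cong (ℚ.toℚᵘ-fromℚᵘ u) (ℚ.toℚᵘ-fromℚᵘ v)))))

fromℕ-homo-+ : ∀ a b → fromℕ (a ℕ.+ b) ≡ fromℕ a + fromℕ b
fromℕ-homo-+ a b = trans (cong (λ z → z / 1) (trans (ℤ.pos-+ a b) (sym (cong₂ ℤ._+_ (ℤ.*-identityʳ (+ a)) (ℤ.*-identityʳ (+ b))))))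
                         (fromℚᵘ-homo-+ (mkℚᵘ (+ a) 0) (mkℚᵘ (+ b) 0))

fromℕ-homo-* : ∀ a b → fromℕ (a ℕ.* b) ≡ fromℕ a * fromℕ b
fromℕ-homo-* a b = trans (cong (λ z → z / 1) (ℤ.pos-* a b)) (fromℚᵘ-homo-* (mkℚᵘ (+ a) 0) (mkℚᵘ (+ b) 0))

reciprocal : ℕ → ℚ
reciprocal k = inv (k ∸ 1)

reciprocal-inverse : ∀ {k} → 1 ≤ k → reciprocal k * fromℕ k ≡ 1ℚ
reciprocal-inverse {suc j} _ = trans (sym (fromℚᵘ-homo-* (mkℚᵘ (+ 1) j) (mkℚᵘ (+ suc j) 0)))
  (ℚ.fromℚᵘ-cong {mkℚᵘ (+ 1) j ℚᵘ.* mkℚᵘ (+ suc j) 0} {ℚᵘ.1ℚᵘ} (*≡* (begin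
    + 1 ℤ.* + suc j ℤ.* + 1   ≡⟨ ℤ.*-identityʳ _ ⟩
    + 1 ℤ.* + suc j           ≡⟨ ℤ.*-identityˡ _ ⟩
    + suc j                   ≡⟨ cong +_ (ℕ.*-identityʳ (suc j)) ⟨
    + (suc j ℕ.* 1)           ≡⟨ ℤ.*-identityˡ _ ⟨
    + 1 ℤ.* + (suc j ℕ.* 1)   ∎)))
  where open ≡-Reasoning

Σ-cong : ∀ m {f g} → (∀ k → 1 ≤ k → k ≤ m → f k ≡ g k) → Σ[1… m ] f ≡ Σ[1… m ] g
Σ-cong zero    f≗g = refl
Σ-cong (suc m) f≗g = cong₂ _+_ (Σ-cong m λ k 1≤k k≤m → f≗g k 1≤k (ℕ.m≤n⇒m≤1+n k≤m))
                                (f≗g (suc m) (s≤s z≤n) ℕ.≤-refl)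

Σ-zero : ∀ m → Σ[1… m ] (λ _ → 0ℚ) ≡ 0ℚ
Σ-zero zero    = refl
Σ-zero (suc m) = cong (_+ 0ℚ) (Σ-zero m)

Σ-distrib-+ : ∀ m f g → Σ[1… m ] (λ k → f k + g k) ≡ Σ[1… m ] f + Σ[1… m ] g
Σ-distrib-+ zero    f g = refl
Σ-distrib-+ (suc m) f g = trans (cong (_+ (f (suc m) + g (suc m))) (Σ-distrib-+ m f g))
  (solve 4 (λ a b c d → (a :+ b) :+ (c :+ d) := (a :+ c) :+ (b :+ d)) refl
           (Σ[1… m ] f) (Σ[1… m ] g) (f (suc m)) (g (suc m)))

Σ-distrib-- : ∀ m f g → Σ[1… m ] (λ k → f k - g k) ≡ Σ[1… m ] f - Σ[1… m ] g
Σ-distrib-- zero    f g = refl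
Σ-distrib-- (suc m) f g = trans (cong (_+ (f (suc m) - g (suc m))) (Σ-distrib-- m f g))
  (solve 4 (λ a b c d → (a :- b) :+ (c :- d) := (a :+ c) :- (b :+ d)) refl
           (Σ[1… m ] f) (Σ[1… m ] g) (f (suc m)) (g (suc m)))

Σ-*ˡ : ∀ m c f → Σ[1… m ] (λ k → c * f k) ≡ c * Σ[1… m ] f
Σ-*ˡ zero    c f = sym (ℚ.*-zeroʳ c)
Σ-*ˡ (suc m) c f = trans (cong (_+ (c * f (suc m))) (Σ-*ˡ m c f)) (sym (ℚ.*-distribˡ-+ c _ _))

Σ-unfoldˡ : ∀ m f → Σ[1… suc m ] f ≡ f 1 + Σ[1… m ] (λ k → f (suc k))
Σ-unfoldˡ zero    f = trans (ℚ.+-identityˡ (f 1)) (sym (ℚ.+-identityʳ (f 1)))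
Σ-unfoldˡ (suc m) f = trans (cong (_+ f (suc (suc m))) (Σ-unfoldˡ m f)) (ℚ.+-assoc (f 1) _ _)

Σ-reverse : ∀ m f → Σ[1… m ] f ≡ Σ[1… m ] (λ k → f (suc m ∸ k))
Σ-reverse zero    f = refl
Σ-reverse (suc m) f = sym (begin
  Σ[1… suc m ] (λ k → f (suc (suc m) ∸ k))     ≡⟨ Σ-unfoldˡ m (λ k → f (suc (suc m) ∸ k)) ⟩
  f (suc m) + Σ[1… m ] (λ k → f (suc m ∸ k))   ≡⟨ cong (λ s → f (suc m) + s) (Σ-reverse m f) ⟨
  f (suc m) + Σ[1… m ] f                       ≡⟨ ℚ.+-comm (f (suc m)) _ ⟩
  Σ[1… suc m ] f                               ∎)
  where open ≡-Reasoning

Σ-comm : ∀ a b (F : ℕ → ℕ → ℚ) →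
         Σ[1… a ] (λ i → Σ[1… b ] (F i)) ≡ Σ[1… b ] (λ j → Σ[1… a ] (λ i → F i j))
Σ-comm zero    b F = sym (Σ-zero b)
Σ-comm (suc a) b F = trans (cong (_+ Σ[1… b ] (F (suc a))) (Σ-comm a b F))
                           (sym (Σ-distrib-+ b (λ j → Σ[1… a ] (λ i → F i j)) (F (suc a))))

δ : ℕ → ℕ → ℚ
δ i j with i ℕ.≟ j
... | yes _ = 1ℚ
... | no  _ = 0ℚ

δ-refl : ∀ i → δ i i ≡ 1ℚ
δ-refl i with i ℕ.≟ i
... | yes _   = refl
... | no  i≢i = contradiction refl i≢i

δ-≢ : ∀ {i j} → i ≢ j → δ i j ≡ 0ℚ
δ-≢ {i} {j} i≢j with i ℕ.≟ j
... | yes i≡j = contradiction i≡j i≢j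
... | no  _   = refl

Σ-δ-beyond : ∀ n c (g : ℕ → ℚ) → n < c → Σ[1… n ] (λ j → δ c j * g j) ≡ 0ℚ
Σ-δ-beyond zero    c g n<c = refl
Σ-δ-beyond (suc n) c g n<c = begin
  Σ[1… n ] (λ j → δ c j * g j) + δ c (suc n) * g (suc n)
    ≡⟨ cong₂ _+_ (Σ-δ-beyond n c g (ℕ.<-trans (ℕ.n<1+n n) n<c))
                 (cong (_* g (suc n)) (δ-≢ (ℕ.>⇒≢ n<c))) ⟩
  0ℚ + 0ℚ * g (suc n)
    ≡⟨ cong (λ s → 0ℚ + s) (ℚ.*-zeroˡ (g (suc n))) ⟩
  0ℚ ∎
  where open ≡-Reasoning

Σ-δ : ∀ n c (g : ℕ → ℚ) → 1 ≤ c → c ≤ n → Σ[1… n ] (λ j → δ c j * g j) ≡ g c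
Σ-δ zero    zero    g () _
Σ-δ zero    (suc c) g _  ()
Σ-δ (suc n) c g 1≤c c≤1+n with ℕ.m≤n⇒m<n∨m≡n c≤1+n
... | inj₁ c<1+n = begin
  Σ[1… n ] (λ j → δ c j * g j) + δ c (suc n) * g (suc n)
    ≡⟨ cong₂ _+_ (Σ-δ n c g 1≤c (ℕ.≤-pred c<1+n)) (cong (_* g (suc n)) (δ-≢ (ℕ.<⇒≢ c<1+n))) ⟩
  g c + 0ℚ * g (suc n)
    ≡⟨ cong (λ s → g c + s) (ℚ.*-zeroˡ (g (suc n))) ⟩
  g c + 0ℚ
    ≡⟨ ℚ.+-identityʳ (g c) ⟩
  g c ∎
  where open ≡-Reasoning
... | inj₂ refl = begin
  Σ[1… n ] (λ j → δ (suc n) j * g j) + δ (suc n) (suc n) * g (suc n)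
    ≡⟨ cong₂ _+_ (Σ-δ-beyond n (suc n) g ℕ.≤-refl) (cong (_* g (suc n)) (δ-refl (suc n))) ⟩
  0ℚ + 1ℚ * g (suc n)
    ≡⟨ ℚ.+-identityˡ _ ⟩
  1ℚ * g (suc n)
    ≡⟨ ℚ.*-identityˡ (g (suc n)) ⟩
  g (suc n) ∎
  where open ≡-Reasoning

module _ (m : ℕ) (σ : ℕ → ℕ)
         (σ-range : ∀ {k} → 1 ≤ k → k ≤ m → 1 ≤ σ k × σ k ≤ m)
         (σ-involutive : ∀ {k} → 1 ≤ k → k ≤ m → σ (σ k) ≡ k) where

  private
    δ-σ : ∀ {k j} → 1 ≤ k → k ≤ m → 1 ≤ j → j ≤ m → δ (σ k) j ≡ δ (σ j) k
    δ-σ {k} {j} 1≤k k≤m 1≤j j≤m = by-cases (σ k ℕ.≟ j)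
      where
      by-cases : Dec (σ k ≡ j) → δ (σ k) j ≡ δ (σ j) k
      by-cases (yes refl) = trans (δ-refl (σ k))
                                  (sym (trans (cong (λ i → δ i k) (σ-involutive 1≤k k≤m)) (δ-refl k)))
      by-cases (no σk≢j)  = trans (δ-≢ σk≢j)
                                  (sym (δ-≢ λ σj≡k → σk≢j (trans (cong σ (sym σj≡k)) (σ-involutive 1≤j j≤m))))

  -- Double counting: Σₖ f (σ k) = Σₖ Σⱼ [σ k = j] f j = Σⱼ f j Σₖ [σ j = k] = Σⱼ f j.
  Σ-involution : ∀ f → Σ[1… m ] (λ k → f (σ k)) ≡ Σ[1… m ] f
  Σ-involution f = begin
    Σ[1… m ] (λ k → f (σ k))
      ≡⟨ Σ-cong m (λ k 1≤k k≤m → sym (uncurry (Σ-δ m (σ k) f) (σ-range 1≤k k≤m))) ⟩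
    Σ[1… m ] (λ k → Σ[1… m ] (λ j → δ (σ k) j * f j))
      ≡⟨ Σ-comm m m (λ k j → δ (σ k) j * f j) ⟩
    Σ[1… m ] (λ j → Σ[1… m ] (λ k → δ (σ k) j * f j))
      ≡⟨ Σ-cong m (λ j 1≤j j≤m → Σ-cong m (λ k 1≤k k≤m → cong (_* f j) (δ-σ 1≤k k≤m 1≤j j≤m))) ⟩
    Σ[1… m ] (λ j → Σ[1… m ] (λ k → δ (σ j) k * f j))
      ≡⟨ Σ-cong m (λ j 1≤j j≤m → uncurry (Σ-δ m (σ j) (λ _ → f j)) (σ-range 1≤j j≤m)) ⟩
    Σ[1… m ] f ∎
    where open ≡-Reasoning

powerSum : ℕ → ℕ → ℚ
powerSum n m = Σ[1… m ] (λ k → reciprocal k ^ℚ n)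

½ ⅓ ¼ ⅙ ⅛ 1/24 : ℚ
½    = + 1 / 2
⅓    = + 1 / 3
¼    = + 1 / 4
⅙    = + 1 / 6
⅛    = + 1 / 8
1/24 = + 1 / 24

e-2-powerSum : ∀ m → e 2 m ≡ ½ * (powerSum 1 m * powerSum 1 m - powerSum 2 m)
e-2-powerSum zero    = refl
e-2-powerSum (suc m) = trans (cong (_+ inv m * e 1 m) (e-2-powerSum m))
  (solve 3 (λ S₁ S₂ x →
      con ½ :* (S₁ :* S₁ :- S₂) :+ x :* S₁
    := con ½ :* ((S₁ :+ x :* con 1ℚ) :* (S₁ :+ x :* con 1ℚ) :- (S₂ :+ x :* (x :* con 1ℚ))))
    refl (powerSum 1 m) (powerSum 2 m) (inv m))

e-3-powerSum : ∀ m → e 3 m ≡ ⅙ * (powerSum 1 m * powerSum 1 m * powerSum 1 m)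
                           - ½ * (powerSum 1 m * powerSum 2 m) + ⅓ * powerSum 3 m
e-3-powerSum zero    = refl
e-3-powerSum (suc m) = trans (cong₂ (λ e₃ e₂ → e₃ + inv m * e₂) (e-3-powerSum m) (e-2-powerSum m))
  (solve 4 (λ S₁ S₂ S₃ x →
      (con ⅙ :* (S₁ :* S₁ :* S₁) :- con ½ :* (S₁ :* S₂) :+ con ⅓ :* S₃) :+ x :* (con ½ :* (S₁ :* S₁ :- S₂))
    := let T₁ = S₁ :+ x :* con 1ℚ ; T₂ = S₂ :+ x :* (x :* con 1ℚ) ; T₃ = S₃ :+ x :* (x :* (x :* con 1ℚ)) in
       con ⅙ :* (T₁ :* T₁ :* T₁) :- con ½ :* (T₁ :* T₂) :+ con ⅓ :* T₃)
    refl (powerSum 1 m) (powerSum 2 m) (powerSum 3 m) (inv m))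

e-4-powerSum : ∀ m → e 4 m ≡ 1/24 * (powerSum 1 m * powerSum 1 m * powerSum 1 m * powerSum 1 m)
                           - ¼ * (powerSum 1 m * powerSum 1 m * powerSum 2 m) + ⅛ * (powerSum 2 m * powerSum 2 m)
                           + ⅓ * (powerSum 1 m * powerSum 3 m) - ¼ * powerSum 4 m
e-4-powerSum zero    = refl
e-4-powerSum (suc m) = trans (cong₂ (λ e₄ e₃ → e₄ + inv m * e₃) (e-4-powerSum m) (e-3-powerSum m))
  (solve 5 (λ S₁ S₂ S₃ S₄ x →
      (con 1/24 :* (S₁ :* S₁ :* S₁ :* S₁) :- con ¼ :* (S₁ :* S₁ :* S₂) :+ con ⅛ :* (S₂ :* S₂)
         :+ con ⅓ :* (S₁ :* S₃) :- con ¼ :* S₄)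
      :+ x :* (con ⅙ :* (S₁ :* S₁ :* S₁) :- con ½ :* (S₁ :* S₂) :+ con ⅓ :* S₃)
    := let T₁ = S₁ :+ x :* con 1ℚ ; T₂ = S₂ :+ x :* (x :* con 1ℚ)
           T₃ = S₃ :+ x :* (x :* (x :* con 1ℚ)) ; T₄ = S₄ :+ x :* (x :* (x :* (x :* con 1ℚ))) in
       con 1/24 :* (T₁ :* T₁ :* T₁ :* T₁) :- con ¼ :* (T₁ :* T₁ :* T₂) :+ con ⅛ :* (T₂ :* T₂)
         :+ con ⅓ :* (T₁ :* T₃) :- con ¼ :* T₄)
    refl (powerSum 1 m) (powerSum 2 m) (powerSum 3 m) (powerSum 4 m) (inv m))

fromℕ-suc : ∀ n → fromℕ (suc n) ≡ 1ℚ + fromℕ n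
fromℕ-suc n = fromℕ-homo-+ 1 n

Σ-squares : ∀ m → Σ[1… m ] (λ k → fromℕ k ^ℚ 2)
                ≡ ⅙ * (fromℕ m * (fromℕ m + 1ℚ) * (fromℕ 2 * fromℕ m + 1ℚ))
Σ-squares zero    = refl
Σ-squares (suc m) = begin
  Σ[1… m ] (λ k → fromℕ k ^ℚ 2) + fromℕ (suc m) ^ℚ 2   ≡⟨ cong₂ _+_ (Σ-squares m) (cong (_^ℚ 2) (fromℕ-suc m)) ⟩
  closed (fromℕ m) + (1ℚ + fromℕ m) ^ℚ 2               ≡⟨ solve 1 (λ M →
      con ⅙ :* (M :* (M :+ con 1ℚ) :* (con (fromℕ 2) :* M :+ con 1ℚ)) :+ (con 1ℚ :+ M) :* ((con 1ℚ :+ M) :* con 1ℚ)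
   := con ⅙ :* ((con 1ℚ :+ M) :* ((con 1ℚ :+ M) :+ con 1ℚ) :* (con (fromℕ 2) :* (con 1ℚ :+ M) :+ con 1ℚ))) refl (fromℕ m) ⟩
  closed (1ℚ + fromℕ m)                                ≡⟨ cong closed (fromℕ-suc m) ⟨
  closed (fromℕ (suc m))                               ∎
  where
  open ≡-Reasoning
  closed : ℚ → ℚ
  closed M = ⅙ * (M * (M + 1ℚ) * (fromℕ 2 * M + 1ℚ))

1/30 : ℚ
1/30 = + 1 / 30

Σ-fourth-powers : ∀ m → Σ[1… m ] (λ k → fromℕ k ^ℚ 4)
                      ≡ 1/30 * (fromℕ m * (fromℕ m + 1ℚ) * (fromℕ 2 * fromℕ m + 1ℚ)
                                * (fromℕ 3 * fromℕ m * fromℕ m + fromℕ 3 * fromℕ m - 1ℚ))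
Σ-fourth-powers zero    = refl
Σ-fourth-powers (suc m) = begin
  Σ[1… m ] (λ k → fromℕ k ^ℚ 4) + fromℕ (suc m) ^ℚ 4   ≡⟨ cong₂ _+_ (Σ-fourth-powers m) (cong (_^ℚ 4) (fromℕ-suc m)) ⟩
  closed (fromℕ m) + (1ℚ + fromℕ m) ^ℚ 4               ≡⟨ solve 1 (λ M →
      let c = λ N → con 1/30 :* (N :* (N :+ con 1ℚ) :* (con (fromℕ 2) :* N :+ con 1ℚ)
                                  :* (con (fromℕ 3) :* N :* N :+ con (fromℕ 3) :* N :- con 1ℚ))
          N = con 1ℚ :+ M in
      c M :+ N :* (N :* (N :* (N :* con 1ℚ))) := c N) refl (fromℕ m) ⟩
  closed (1ℚ + fromℕ m)                                ≡⟨ cong closed (fromℕ-suc m) ⟨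
  closed (fromℕ (suc m))                               ∎
  where
  open ≡-Reasoning
  closed : ℚ → ℚ
  closed M = 1/30 * (M * (M + 1ℚ) * (fromℕ 2 * M + 1ℚ) * (fromℕ 3 * M * M + fromℕ 3 * M - 1ℚ))

cancel-zero-term : ∀ {r} x y G → r ≡ 0ℚ → x ≡ y + r * G → x ≡ y
cancel-zero-term x y G refl x≡y+0 = trans x≡y+0 (trans (cong (λ s → y + s) (ℚ.*-zeroˡ G)) (ℚ.+-identityʳ y))

reciprocals-sum : ∀ a b K L → a * K ≡ 1ℚ → b * L ≡ 1ℚ → a + b - (K + L) * (a * b) ≡ 0ℚ
reciprocals-sum a b K L aK≡1 bL≡1 = begin
  a + b - (K + L) * (a * b)                  ≡⟨ solve 4 (λ a b K L → a :+ b :- (K :+ L) :* (a :* b)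
                                                   := a :* (con 1ℚ :- b :* L) :+ b :* (con 1ℚ :- a :* K)) refl a b K L ⟩
  a * (1ℚ - b * L) + b * (1ℚ - a * K)        ≡⟨ cong₂ (λ u v → a * (1ℚ - u) + b * (1ℚ - v)) bL≡1 aK≡1 ⟩
  a * (1ℚ - 1ℚ) + b * (1ℚ - 1ℚ)              ≡⟨ solve 2 (λ a b → a :* (con 1ℚ :- con 1ℚ) :+ b :* (con 1ℚ :- con 1ℚ)
                                                            := con 0ℚ) refl a b ⟩
  0ℚ                                         ∎
  where open ≡-Reasoning

-- a = 1/k and b = 1/(Q - k) satisfy a + b = Q a b; modulo Q² this gives
-- b ≡ - a - Q a² and b³ ≡ - a³ - 3 Q a⁴.
pair-identity₁ : ∀ a b Q → a + b - Q * (a * b) ≡ 0ℚ →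
                 a ^ℚ 1 + b ^ℚ 1 + Q * a ^ℚ 2 ≡ Q ^ℚ 2 * (a * a * b)
pair-identity₁ a b Q r≡0 = cancel-zero-term _ _ (1ℚ + Q * a) r≡0
  (solve 3 (λ a b Q → a :* con 1ℚ :+ b :* con 1ℚ :+ Q :* (a :* (a :* con 1ℚ))
             := Q :* (Q :* con 1ℚ) :* (a :* a :* b) :+ (a :+ b :- Q :* (a :* b)) :* (con 1ℚ :+ Q :* a)) refl a b Q)

pair-identity₃ : ∀ a b Q → a + b - Q * (a * b) ≡ 0ℚ →
                 a ^ℚ 3 + b ^ℚ 3 + fromℕ 3 * Q * a ^ℚ 4
                   ≡ Q ^ℚ 2 * (Q * (a * b) ^ℚ 3 - fromℕ 3 * (a ^ℚ 3 * b * (b - a)))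
pair-identity₃ a b Q r≡0 = cancel-zero-term _ _ G r≡0
  (solve 3 (λ a b Q →
      let s = a :+ b ; t = a :* b ; 3# = con (fromℕ 3) in
      a :* (a :* (a :* con 1ℚ)) :+ b :* (b :* (b :* con 1ℚ)) :+ 3# :* Q :* (a :* (a :* (a :* (a :* con 1ℚ))))
    := Q :* (Q :* con 1ℚ) :* (Q :* (t :* (t :* (t :* con 1ℚ))) :- 3# :* (a :* (a :* (a :* con 1ℚ)) :* b :* (b :- a)))
       :+ (s :- Q :* t) :* (s :* s :+ s :* (Q :* t) :+ Q :* Q :* (t :* t) :- 3# :* t :+ 3# :* Q :* (a :* a :* (a :- b))))
    refl a b Q)
  where
  s = a + b
  t = a * b
  G = s * s + s * (Q * t) + Q * Q * (t * t) - fromℕ 3 * t + fromℕ 3 * Q * (a * a * (a - b))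

inverse-difference : ∀ a K S Q X → a * K ≡ 1ℚ → K * S ≡ 1ℚ + Q * X → a - S ≡ X * (- (a * Q))
inverse-difference a K S Q X aK≡1 KS≡1+QX = begin
  a - S                        ≡⟨ cong (λ u → a - u) (ℚ.*-identityˡ S) ⟨
  a - 1ℚ * S                   ≡⟨ cong (λ u → a - u * S) aK≡1 ⟨
  a - a * K * S                ≡⟨ cong (λ u → a - u) (ℚ.*-assoc a K S) ⟩
  a - a * (K * S)              ≡⟨ cong (λ u → a - a * u) KS≡1+QX ⟩
  a - a * (1ℚ + Q * X)         ≡⟨ solve 3 (λ a Q X → a :- a :* (con 1ℚ :+ Q :* X) := X :* (:- (a :* Q))) refl a Q X ⟩
  X * (- (a * Q))              ∎
  where open ≡-Reasoning

module PAdic {p : ℕ} (p-prime : Prime p) where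

  P : ℚ
  P = fromℕ p

  -- A record rather than pIntegral p x itself, so that x is inferable from the type.
  record Integral (x : ℚ) : Set where
    constructor integral
    field p∤denominator : pIntegral p x

  record P^_∣_ (m : ℕ) (x : ℚ) : Set where
    constructor factor
    field
      quotient          : ℚ
      quotient-integral : Integral quotient
      factorisation     : x ≡ P ^ℚ m * quotient

  private
    prime∤* : ∀ {a b} → ¬ p ∣ a → ¬ p ∣ b → ¬ p ∣ a ℕ.* b
    prime∤* {a} {b} p∤a p∤b p∣ab with euclidsLemma a b p-prime p∣ab
    ... | inj₁ p∣a = p∤a p∣a
    ... | inj₂ p∣b = p∤b p∣b

  integral-+ : ∀ {x y} → Integral x → Integral y → Integral (x + y)
  integral-+ {x} {y} (integral px) (integral py) = integral λ p∣ → prime∤* px py (∣-trans p∣ (↧ₙ-+-∣ x y))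

  integral-* : ∀ {x y} → Integral x → Integral y → Integral (x * y)
  integral-* {x} {y} (integral px) (integral py) = integral λ p∣ → prime∤* px py (∣-trans p∣ (↧ₙ-*-∣ x y))

  integral-neg : ∀ {x} → Integral x → Integral (- x)
  integral-neg {x} (integral px) = integral (subst (λ d → ¬ p ∣ d) (sym (cong ℤ.∣_∣ (ℚ.↧-neg x))) px)

  integral-- : ∀ {x y} → Integral x → Integral y → Integral (x - y)
  integral-- ix iy = integral-+ ix (integral-neg iy)

  integral-fromℕ : ∀ n → Integral (fromℕ n)
  integral-fromℕ n = integral λ p∣ → ¬prime[1] (subst Prime (∣1⇒≡1 (∣-trans p∣ (↧ₙ-/-∣ (+ n) 1))) p-prime)

  integral-^ : ∀ {x} n → Integral x → Integral (x ^ℚ n)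
  integral-^ zero    ix = integral-fromℕ 1
  integral-^ (suc n) ix = integral-* ix (integral-^ n ix)

  integral-inv : ∀ j → suc j < p → Integral (inv j)
  integral-inv j j<p = integral λ p∣ → ℕ.<⇒≱ j<p (∣⇒≤ (∣-trans p∣ (↧ₙ-/-∣ (+ 1) (suc j))))

  P^∣-0 : ∀ {m} → P^ m ∣ 0ℚ
  P^∣-0 {m} = factor 0ℚ (integral-fromℕ 0) (sym (ℚ.*-zeroʳ (P ^ℚ m)))

  P^∣-+ : ∀ {m x y} → P^ m ∣ x → P^ m ∣ y → P^ m ∣ (x + y)
  P^∣-+ {m} (factor c ic refl) (factor d id refl) =
    factor (c + d) (integral-+ ic id) (sym (ℚ.*-distribˡ-+ (P ^ℚ m) c d))

  P^∣-neg : ∀ {m x} → P^ m ∣ x → P^ m ∣ (- x)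
  P^∣-neg {m} (factor c ic refl) = factor (- c) (integral-neg ic) (ℚ.neg-distribʳ-* (P ^ℚ m) c)

  P^∣-- : ∀ {m x y} → P^ m ∣ x → P^ m ∣ y → P^ m ∣ (x - y)
  P^∣-- dx dy = P^∣-+ dx (P^∣-neg dy)

  P^∣-scale : ∀ {m c x} → Integral c → P^ m ∣ x → P^ m ∣ (c * x)
  P^∣-scale {m} {c} ic (factor d id refl) = factor (c * d) (integral-* ic id)
    (solve 3 (λ A c d → c :* (A :* d) := A :* (c :* d)) refl (P ^ℚ m) c d)

  ^ℚ-+ : ∀ x a b → x ^ℚ (a ℕ.+ b) ≡ x ^ℚ a * x ^ℚ b
  ^ℚ-+ x zero    b = sym (ℚ.*-identityˡ (x ^ℚ b))
  ^ℚ-+ x (suc a) b = trans (cong (x *_) (^ℚ-+ x a b)) (sym (ℚ.*-assoc x (x ^ℚ a) (x ^ℚ b)))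

  P^∣-* : ∀ {a b x y} → P^ a ∣ x → P^ b ∣ y → P^ (a ℕ.+ b) ∣ (x * y)
  P^∣-* {a} {b} (factor c ic refl) (factor d id refl) = factor (c * d) (integral-* ic id)
    (trans (solve 4 (λ A B c d → (A :* c) :* (B :* d) := (A :* B) :* (c :* d)) refl (P ^ℚ a) (P ^ℚ b) c d)
           (cong (_* (c * d)) (sym (^ℚ-+ P a b))))

  P^∣-weaken : ∀ {m} k {x} → P^ (k ℕ.+ m) ∣ x → P^ m ∣ x
  P^∣-weaken {m} k (factor c ic refl) = factor (P ^ℚ k * c) (integral-* (integral-^ k (integral-fromℕ p)) ic)
    (trans (cong (_* c) (trans (^ℚ-+ P k m) (ℚ.*-comm (P ^ℚ k) (P ^ℚ m)))) (ℚ.*-assoc (P ^ℚ m) (P ^ℚ k) c))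

  P^∣⇒≡[mod] : ∀ {m a b} → P^ m ∣ (a - b) → a ≡ b [mod p ^ m ]
  P^∣⇒≡[mod] (factor c (integral pc) eq) = c , pc , eq

  P^∣⇒∣ℚ : ∀ {m x} → P^ m ∣ x → p ^ m ∣ℚ x
  P^∣⇒∣ℚ {x = x} = P^∣⇒≡[mod] {a = x} {0ℚ} ∘ subst (P^ _ ∣_) (sym (ℚ.+-identityʳ x))

  P^0∣ : ∀ {c} → Integral c → P^ 0 ∣ c
  P^0∣ {c} ic = factor c ic (sym (ℚ.*-identityˡ c))

  P^∣-Σ : ∀ {m} n {f} → (∀ k → 1 ≤ k → k ≤ n → P^ m ∣ f k) → P^ m ∣ Σ[1… n ] f
  P^∣-Σ zero    _   = P^∣-0
  P^∣-Σ (suc n) P∣f = P^∣-+ (P^∣-Σ n λ k 1≤k k≤n → P∣f k 1≤k (ℕ.m≤n⇒m≤1+n k≤n))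
                            (P∣f (suc n) (s≤s z≤n) ℕ.≤-refl)

  P^∣-P* : ∀ {m x} → P^ m ∣ x → P^ (suc m) ∣ (P * x)
  P^∣-P* {m} (factor c ic refl) = factor c ic (sym (ℚ.*-assoc P (P ^ℚ m) c))

  P^∣-^-difference : ∀ {m x y} n → Integral x → Integral y → P^ m ∣ (x - y) → P^ m ∣ (x ^ℚ n - y ^ℚ n)
  P^∣-^-difference zero    _  _  _   = P^∣-0
  P^∣-^-difference {x = x} {y} (suc n) ix iy x-y =
    subst (P^ _ ∣_) (solve 4 (λ x y X Y → x :* (X :- Y) :+ Y :* (x :- y) := x :* X :- y :* Y) refl x y (x ^ℚ n) (y ^ℚ n))
      (P^∣-+ (P^∣-scale ix (P^∣-^-difference n ix iy x-y)) (P^∣-scale (integral-^ n iy) x-y))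

module PowerSumCongruences (m : ℕ) (p-prime : Prime (suc m)) (7≤p : 7 ≤ suc m) where

  open PAdic p-prime
  open ModularInverse m p-prime

  private
    integral-small : ∀ j → j ≤ 5 → Integral (inv j)
    integral-small j j≤5 = integral-inv j (ℕ.≤-trans (s≤s (s≤s j≤5)) 7≤p)

    integral-½ : Integral ½
    integral-½ = integral-small 1 (s≤s z≤n)

    integral-⅓ : Integral ⅓
    integral-⅓ = integral-small 2 (s≤s (s≤s z≤n))

    integral-¼ : Integral ¼
    integral-¼ = integral-small 3 (s≤s (s≤s (s≤s z≤n)))

    integral-⅙ : Integral ⅙
    integral-⅙ = integral-small 5 ℕ.≤-refl

    integral-⅛ : Integral ⅛
    integral-⅛ = integral-* integral-½ integral-¼

    integral-1/24 : Integral 1/24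
    integral-1/24 = integral-* integral-¼ integral-⅙

    integral-1/30 : Integral 1/30
    integral-1/30 = integral-* integral-⅙ (integral-small 4 (s≤s (s≤s (s≤s (s≤s z≤n)))))

  integral-reciprocal : ∀ {k} → 1 ≤ k → k ≤ m → Integral (reciprocal k)
  integral-reciprocal {suc j} _ k≤m = integral-inv j (s≤s k≤m)

  fromℕ-m+1≡P : fromℕ m + 1ℚ ≡ P
  fromℕ-m+1≡P = trans (ℚ.+-comm (fromℕ m) 1ℚ) (sym (fromℕ-suc m))

  pairTerm : ℕ → ℕ → ℚ
  pairTerm i k = reciprocal k ^ℚ i + reciprocal (p ∸ k) ^ℚ i + fromℕ i * P * reciprocal k ^ℚ suc i

  module _ {k} (1≤k : 1 ≤ k) (k≤m : k ≤ m) where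

    private
      a b : ℚ
      a = reciprocal k
      b = reciprocal (p ∸ k)
      1≤p∸k : 1 ≤ p ∸ k
      1≤p∸k = ℕ.m<n⇒0<n∸m (s≤s k≤m)
      ia : Integral a
      ia = integral-reciprocal 1≤k k≤m
      ib : Integral b
      ib = integral-reciprocal 1≤p∸k (ℕ.∸-monoʳ-≤ p 1≤k)

    reciprocal-pair : a + b - P * (a * b) ≡ 0ℚ
    reciprocal-pair = subst (λ Q → a + b - Q * (a * b) ≡ 0ℚ) k+[p∸k]≡P
      (reciprocals-sum a b (fromℕ k) (fromℕ (p ∸ k)) (reciprocal-inverse 1≤k) (reciprocal-inverse 1≤p∸k))
      where
      k+[p∸k]≡P : fromℕ k + fromℕ (p ∸ k) ≡ P
      k+[p∸k]≡P = trans (sym (fromℕ-homo-+ k (p ∸ k))) (cong fromℕ (ℕ.m+[n∸m]≡n (ℕ.m≤n⇒m≤1+n k≤m)))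

    P²∣pairTerm₁ : P^ 2 ∣ pairTerm 1 k
    P²∣pairTerm₁ = factor _ (integral-* (integral-* ia ia) ib)
      (trans (cong (λ u → a ^ℚ 1 + b ^ℚ 1 + u * a ^ℚ 2) (ℚ.*-identityˡ P)) (pair-identity₁ a b P reciprocal-pair))

    P²∣pairTerm₃ : P^ 2 ∣ pairTerm 3 k
    P²∣pairTerm₃ = factor _ (integral-- (integral-* (integral-fromℕ p) (integral-^ 3 (integral-* ia ib)))
                                    (integral-* (integral-fromℕ 3) (integral-* (integral-* (integral-^ 3 ia) ib) (integral-- ib ia))))
      (pair-identity₃ a b P reciprocal-pair)

    P∣reciprocal-inverse : P^ 1 ∣ (a - fromℕ (inverse k))
    P∣reciprocal-inverse = subst (P^ 1 ∣_) (sym (inverse-difference a K S Q P (reciprocal-inverse 1≤k) KS≡1+QP))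
      (P^∣-P* (P^0∣ (integral-neg (integral-* ia (integral-fromℕ q)))))
      where
      s = inverse k
      q = k ℕ.* s ℕ./ p
      K S Q : ℚ
      K = fromℕ k
      S = fromℕ s
      Q = fromℕ q
      KS≡1+QP : K * S ≡ 1ℚ + Q * P
      KS≡1+QP = begin
        K * S                        ≡⟨ fromℕ-homo-* k s ⟨
        fromℕ (k ℕ.* s)              ≡⟨ cong fromℕ (IsInverse⇒≡1+qp k s (proj₂ (proj₂ (inverse-spec 1≤k k≤m)))) ⟩
        fromℕ (1 ℕ.+ q ℕ.* p)        ≡⟨ fromℕ-homo-+ 1 (q ℕ.* p) ⟩
        1ℚ + fromℕ (q ℕ.* p)         ≡⟨ cong (λ u → 1ℚ + u) (fromℕ-homo-* q p) ⟩
        1ℚ + Q * P                   ∎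
        where open ≡-Reasoning

  powerSum-≡-Σ-powers : ∀ n → P^ 1 ∣ (powerSum n m - Σ[1… m ] (λ k → fromℕ k ^ℚ n))
  powerSum-≡-Σ-powers n = subst (P^ 1 ∣_) Σ-rearranged
    (P^∣-Σ m λ k 1≤k k≤m → P^∣-^-difference n (integral-reciprocal 1≤k k≤m) (integral-fromℕ (inverse k))
                                                (P∣reciprocal-inverse 1≤k k≤m))
    where
    Σ-rearranged : Σ[1… m ] (λ k → reciprocal k ^ℚ n - fromℕ (inverse k) ^ℚ n)
                 ≡ powerSum n m - Σ[1… m ] (λ k → fromℕ k ^ℚ n)
    Σ-rearranged = trans (Σ-distrib-- m (λ k → reciprocal k ^ℚ n) (λ k → fromℕ (inverse k) ^ℚ n))
      (cong (λ u → powerSum n m - u) (Σ-involution m inverse inverse-range inverse-involutive (λ k → fromℕ k ^ℚ n)))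

  P∣powerSum : ∀ n → P^ 1 ∣ Σ[1… m ] (λ k → fromℕ k ^ℚ n) → P^ 1 ∣ powerSum n m
  P∣powerSum n P∣Σ = subst (P^ 1 ∣_) (solve 2 (λ x y → x :- y :+ y := x) refl (powerSum n m) _)
    (P^∣-+ (powerSum-≡-Σ-powers n) P∣Σ)

  private
    M X Y : ℚ
    M = fromℕ m
    X = fromℕ 2 * M + 1ℚ
    Y = fromℕ 3 * M * M + fromℕ 3 * M - 1ℚ

    iM : Integral M
    iM = integral-fromℕ m

    iX : Integral X
    iX = integral-+ (integral-* (integral-fromℕ 2) iM) (integral-fromℕ 1)

    iY : Integral Y
    iY = integral-- (integral-+ (integral-* (integral-* (integral-fromℕ 3) iM) iM) (integral-* (integral-fromℕ 3) iM))
                    (integral-fromℕ 1)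

  P∣Σ-squares : P^ 1 ∣ Σ[1… m ] (λ k → fromℕ k ^ℚ 2)
  P∣Σ-squares = factor _ (integral-* integral-⅙ (integral-* iM iX)) (begin
    Σ[1… m ] (λ k → fromℕ k ^ℚ 2)     ≡⟨ Σ-squares m ⟩
    ⅙ * (M * (M + 1ℚ) * X)            ≡⟨ cong (λ Q → ⅙ * (M * Q * X)) fromℕ-m+1≡P ⟩
    ⅙ * (M * P * X)                   ≡⟨ solve 3 (λ M P X → con ⅙ :* (M :* P :* X) := P :* con 1ℚ :* (con ⅙ :* (M :* X))) refl M P X ⟩
    P ^ℚ 1 * (⅙ * (M * X))            ∎)
    where open ≡-Reasoning

  P∣Σ-fourth-powers : P^ 1 ∣ Σ[1… m ] (λ k → fromℕ k ^ℚ 4)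
  P∣Σ-fourth-powers = factor _ (integral-* integral-1/30 (integral-* (integral-* iM iX) iY)) (begin
    Σ[1… m ] (λ k → fromℕ k ^ℚ 4)     ≡⟨ Σ-fourth-powers m ⟩
    1/30 * (M * (M + 1ℚ) * X * Y)     ≡⟨ cong (λ Q → 1/30 * (M * Q * X * Y)) fromℕ-m+1≡P ⟩
    1/30 * (M * P * X * Y)            ≡⟨ solve 4 (λ M P X Y → con 1/30 :* (M :* P :* X :* Y)
                                             := P :* con 1ℚ :* (con 1/30 :* (M :* X :* Y))) refl M P X Y ⟩
    P ^ℚ 1 * (1/30 * (M * X * Y))     ∎)
    where open ≡-Reasoning

  Σ-pairTerm : ∀ i → Σ[1… m ] (pairTerm i) ≡ powerSum i m + powerSum i m + fromℕ i * P * powerSum (suc i) m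
  Σ-pairTerm i = begin
    Σ[1… m ] (λ k → f k + f (p ∸ k) + c * g k)            ≡⟨ Σ-distrib-+ m (λ k → f k + f (p ∸ k)) (λ k → c * g k) ⟩
    Σ[1… m ] (λ k → f k + f (p ∸ k)) + Σ[1… m ] (λ k → c * g k)
                                                          ≡⟨ cong₂ _+_ (Σ-distrib-+ m f (λ k → f (p ∸ k))) (Σ-*ˡ m c g) ⟩
    Σ[1… m ] f + Σ[1… m ] (λ k → f (p ∸ k)) + c * Σ[1… m ] g
                                                          ≡⟨ cong (λ u → Σ[1… m ] f + u + c * Σ[1… m ] g) (Σ-reverse m f) ⟨
    powerSum i m + powerSum i m + c * powerSum (suc i) m  ∎
    where
    open ≡-Reasoning
    f g : ℕ → ℚ
    f k = reciprocal k ^ℚ i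
    g k = reciprocal k ^ℚ suc i
    c = fromℕ i * P

  P²∣powerSum-odd : ∀ i → (∀ {k} → 1 ≤ k → k ≤ m → P^ 2 ∣ pairTerm i k) →
                    P^ 1 ∣ powerSum (suc i) m → P^ 2 ∣ powerSum i m
  P²∣powerSum-odd i P²∣pairTerm P∣next = subst (P^ 2 ∣_)
    (solve 4 (λ x y c P → con ½ :* ((x :+ x :+ c :* P :* y) :- c :* (P :* y)) := x) refl
             (powerSum i m) (powerSum (suc i) m) (fromℕ i) P)
    (P^∣-scale integral-½ (P^∣-- (subst (P^ 2 ∣_) (Σ-pairTerm i) (P^∣-Σ m λ k 1≤k k≤m → P²∣pairTerm 1≤k k≤m))
                                  (P^∣-scale (integral-fromℕ i) (P^∣-P* P∣next))))

  private
    R₁ R₂ R₃ R₄ : ℚ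
    R₁ = powerSum 1 m
    R₂ = powerSum 2 m
    R₃ = powerSum 3 m
    R₄ = powerSum 4 m

  P∣R₂ : P^ 1 ∣ R₂
  P∣R₂ = P∣powerSum 2 P∣Σ-squares

  P∣R₄ : P^ 1 ∣ R₄
  P∣R₄ = P∣powerSum 4 P∣Σ-fourth-powers

  P²∣R₁ : P^ 2 ∣ R₁
  P²∣R₁ = P²∣powerSum-odd 1 P²∣pairTerm₁ P∣R₂

  P²∣R₃ : P^ 2 ∣ R₃
  P²∣R₃ = P²∣powerSum-odd 3 P²∣pairTerm₃ P∣R₄

  private
    P⁴∣R₁² : P^ 4 ∣ (R₁ * R₁)
    P⁴∣R₁² = P^∣-* P²∣R₁ P²∣R₁

    P⁶∣R₁³ : P^ 6 ∣ (R₁ * R₁ * R₁)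
    P⁶∣R₁³ = P^∣-* P⁴∣R₁² P²∣R₁

    P⁸∣R₁⁴ : P^ 8 ∣ (R₁ * R₁ * R₁ * R₁)
    P⁸∣R₁⁴ = P^∣-* P⁶∣R₁³ P²∣R₁

    P³∣R₁R₂ : P^ 3 ∣ (R₁ * R₂)
    P³∣R₁R₂ = P^∣-* P²∣R₁ P∣R₂

    P⁵∣R₁²R₂ : P^ 5 ∣ (R₁ * R₁ * R₂)
    P⁵∣R₁²R₂ = P^∣-* P⁴∣R₁² P∣R₂

    P²∣R₂² : P^ 2 ∣ (R₂ * R₂)
    P²∣R₂² = P^∣-* P∣R₂ P∣R₂

    P⁴∣R₁R₃ : P^ 4 ∣ (R₁ * R₃)
    P⁴∣R₁R₃ = P^∣-* P²∣R₁ P²∣R₃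

  H₃-congruence : e 3 m ≡ ⅓ * R₃ - ½ * (R₁ * R₂) [mod p ^ 6 ]
  H₃-congruence = P^∣⇒≡[mod] {a = e 3 m} $ subst (P^ 6 ∣_) (sym (begin
    e 3 m - (⅓ * R₃ - ½ * (R₁ * R₂))
      ≡⟨ cong (λ u → u - (⅓ * R₃ - ½ * (R₁ * R₂))) (e-3-powerSum m) ⟩
    ⅙ * (R₁ * R₁ * R₁) - ½ * (R₁ * R₂) + ⅓ * R₃ - (⅓ * R₃ - ½ * (R₁ * R₂))
      ≡⟨ solve 3 (λ R₁ R₂ R₃ →
           con ⅙ :* (R₁ :* R₁ :* R₁) :- con ½ :* (R₁ :* R₂) :+ con ⅓ :* R₃ :- (con ⅓ :* R₃ :- con ½ :* (R₁ :* R₂))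
         := con ⅙ :* (R₁ :* R₁ :* R₁)) refl R₁ R₂ R₃ ⟩
    ⅙ * (R₁ * R₁ * R₁)
      ∎))
    (P^∣-scale integral-⅙ P⁶∣R₁³)
    where open ≡-Reasoning

  H₄-congruence : e 4 m ≡ ⅛ * (R₂ * R₂) - ¼ * R₄ [mod p ^ 4 ]
  H₄-congruence = P^∣⇒≡[mod] {a = e 4 m} $ subst (P^ 4 ∣_) (sym (begin
    e 4 m - (⅛ * (R₂ * R₂) - ¼ * R₄)
      ≡⟨ cong (λ u → u - (⅛ * (R₂ * R₂) - ¼ * R₄)) (e-4-powerSum m) ⟩
    1/24 * (R₁ * R₁ * R₁ * R₁) - ¼ * (R₁ * R₁ * R₂) + ⅛ * (R₂ * R₂) + ⅓ * (R₁ * R₃) - ¼ * R₄ - (⅛ * (R₂ * R₂) - ¼ * R₄)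
      ≡⟨ solve 4 (λ R₁ R₂ R₃ R₄ →
           con 1/24 :* (R₁ :* R₁ :* R₁ :* R₁) :- con ¼ :* (R₁ :* R₁ :* R₂) :+ con ⅛ :* (R₂ :* R₂)
             :+ con ⅓ :* (R₁ :* R₃) :- con ¼ :* R₄ :- (con ⅛ :* (R₂ :* R₂) :- con ¼ :* R₄)
         := con 1/24 :* (R₁ :* R₁ :* R₁ :* R₁) :- con ¼ :* (R₁ :* R₁ :* R₂) :+ con ⅓ :* (R₁ :* R₃)) refl R₁ R₂ R₃ R₄ ⟩
    1/24 * (R₁ * R₁ * R₁ * R₁) - ¼ * (R₁ * R₁ * R₂) + ⅓ * (R₁ * R₃)
      ∎))
    (P^∣-+ (P^∣-- (P^∣-scale integral-1/24 (P^∣-weaken 4 P⁸∣R₁⁴)) (P^∣-scale integral-¼ (P^∣-weaken 1 P⁵∣R₁²R₂)))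
           (P^∣-scale integral-⅓ P⁴∣R₁R₃))
    where open ≡-Reasoning

  p²∣H₃ : p ^ 2 ∣ℚ e 3 m
  p²∣H₃ = P^∣⇒∣ℚ $ subst (P^ 2 ∣_) (sym (e-3-powerSum m))
    (P^∣-+ (P^∣-- (P^∣-scale integral-⅙ (P^∣-weaken 4 P⁶∣R₁³)) (P^∣-scale integral-½ (P^∣-weaken 1 P³∣R₁R₂)))
           (P^∣-scale integral-⅓ P²∣R₃))

  p∣H₂ : p ^ 1 ∣ℚ e 2 m
  p∣H₂ = P^∣⇒∣ℚ $ subst (P^ 1 ∣_) (sym (e-2-powerSum m))
    (P^∣-scale integral-½ (P^∣-- (P^∣-weaken 3 P⁴∣R₁²) P∣R₂))

  p∣H₄ : p ^ 1 ∣ℚ e 4 m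
  p∣H₄ = P^∣⇒∣ℚ $ subst (P^ 1 ∣_) (sym (e-4-powerSum m))
    (P^∣-- (P^∣-+ (P^∣-+ (P^∣-- (P^∣-scale integral-1/24 (P^∣-weaken 7 P⁸∣R₁⁴))
                               (P^∣-scale integral-¼ (P^∣-weaken 4 P⁵∣R₁²R₂)))
                        (P^∣-scale integral-⅛ (P^∣-weaken 1 P²∣R₂²)))
                 (P^∣-scale integral-⅓ (P^∣-weaken 3 P⁴∣R₁R₃)))
           (P^∣-scale integral-¼ P∣R₄))

lemma2p2 : (p : ℕ) → Prime p → 7 ≤ p →
    (H 3 p ≡ ((+ 1) / 3) * R 3 p - ((+ 1) / 2) * (R 1 p * R 2 p) [mod p ^ 6 ])
    × (H 4 p ≡ ((+ 1) / 8) * (R 2 p * R 2 p) - ((+ 1) / 4) * R 4 p [mod p ^ 4 ])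
    × (p ^ 2 ∣ℚ H 3 p)
    × (p ^ 1 ∣ℚ H 2 p)
    × (p ^ 1 ∣ℚ H 4 p)
lemma2p2 (suc m) p-prime 7≤p = H₃-congruence , H₄-congruence , p²∣H₃ , p∣H₂ , p∣H₄
  where open PowerSumCongruences m p-prime 7≤p
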